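{- Let $H$ be a graph, let $G$ be a minimal obstruction to $H$-coloring, and let $U$ and $W$ be two non-empty disjoint subsets of $V(G)$. Let $J:=\mathsf{hull}(G-U,H)$. If there exists a homomorphism $\phi$ from $G[U]$ to $J[W]$, then there exists a vertex $u\in U$ such that $N_G(u)\setminus U\not\subseteq N_J(\phi(u))$.
   Context: All graphs are finite and simple. For graphs $G$ and $H$, an $H$-coloring (homomorphism) of $G$ to $H$ is a map $c: V(G)\to V(H)$ such that $c(u)c(v)\in E(H)$ for every edge $uv\in E(G)$. A graph $G$ is a minimal obstruction to $H$-coloring if $G$ has no $H$-coloring but every proper induced subgraph of $G$ has an $H$-coloring. For $U\subseteq V(G)$, $G[U]$ is the induced subgraph on $U$ and $G-U=G[V(G)\setminus U]$; $N_G(u)$ is the neighborhood of $u$ in $G$. For graphs $G,H$ such that $G$ has an $H$-coloring, $\mathsf{hull}(G,H)$ is the graph with vertex set $V(G)$ in which $uv$ is an edge if and only if $c(u)c(v)\in E(H)$ for every $H$-coloring $c$ of $G$. -}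

module Defs where

open import Data.Nat using (ℕ)
open import Data.Fin using (Fin)
open import Data.Bool using (Bool; true; false; not; T)
open import Data.Product using (Σ; ∃; _×_; _,_; proj₁; proj₂)
open import Data.Empty using (⊥)
open import Relation.Nullary using (¬_; Dec)
open import Function.Bundles using (_↔_)

record Graph : Set₁ where
  field
    V      : Set
    E      : V → V → Set
    E-sym  : ∀ {u v} → E u v → E v u
    E-irr  : ∀ {u} → ¬ E u u
open Graph public

Finite : Graph → Set
Finite G = Σ ℕ λ n → V G ↔ Fin n

-- Decidable adjacency (every finite simple graph has it classically).
DecAdj : Graph → Set
DecAdj G = ∀ u v → Dec (E G u v)

VSubset : Graph → Set
VSubset G = V G → Bool

_∈ᵥ_ : {G : Graph} → V G → VSubset G → Set
v ∈ᵥ S = T (S v)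

_∉ᵥ_ : {G : Graph} → V G → VSubset G → Set
v ∉ᵥ S = ¬ T (S v)

induced : (G : Graph) → VSubset G → Graph
induced G S = record
  { V     = Σ (V G) (λ v → T (S v))
  ; E     = λ u v → E G (proj₁ u) (proj₁ v)
  ; E-sym = E-sym G
  ; E-irr = E-irr G
  }

compl : {G : Graph} → VSubset G → VSubset G
compl S v = not (S v)

_minus_ : (G : Graph) → VSubset G → Graph
G minus U = induced G (compl {G} U)

record Hom (G H : Graph) : Set where
  field
    map  : V G → V H
    pres : ∀ {u v} → E G u v → E H (map u) (map v)
open Hom public

record MinObs (G H : Graph) : Set₁ where
  field
    noHom   : ¬ Hom G H
    properHom : (S : VSubset G) → (∃ λ v → ¬ T (S v)) → Hom (induced G S) H
open MinObs public

-- hull(G, H), defined when G has an H-coloring (the coloring witness is only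
-- used to show irreflexivity; the edge relation does not depend on it).
hull : (G H : Graph) → Hom G H → Graph
hull G H c₀ = record
  { V     = V G
  ; E     = λ u v → (c : Hom G H) → E H (map c u) (map c v)
  ; E-sym = λ e c → E-sym H (e c)
  ; E-irr = λ e → E-irr H (e c₀)
  }

∈⇒¬∈compl : (b : Bool) → T b → ¬ T (not b)
∈⇒¬∈compl true _ ()

{-# OPTIONS --safe #-}
module Submission where

open import Defs
open import Data.Bool using (true; false; T; not)
open import Data.Unit using (tt)
open import Data.Product using (Σ; ∃; ∃₂; _×_; _,_; proj₁; proj₂)
open import Data.Sum using (_⊎_; inj₁; inj₂)
open import Data.Fin using (Fin)
open import Data.Fin.Properties using (any?)
open import Function using (_∘_)
open import Function.Bundles using (_↔_; Inverse)
open import Relation.Nullary using (¬_; Dec; no)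
open import Relation.Nullary.Decidable using (map′; ¬?; _×-dec_; decidable-stable)
open import Relation.Binary.PropositionalEquality using (subst; sym)

-- Let c₀ be an H-colouring of G − U. If every edge ux with u ∈ U, x ∉ U
-- satisfied φ(u) ~_J x, then in particular c₀(φ(u)) ~_H c₀(x), and colouring
-- U by c₀ ∘ φ and the rest by c₀ would H-colour G. Since G is finite with
-- decidable adjacency, a cross edge violating this for c₀ can be found by
-- search, and its endpoint u is the required vertex.

T-or-T-not : ∀ b → T b ⊎ T (not b)
T-or-T-not true  = inj₁ tt
T-or-T-not false = inj₂ tt

Σ-T? : ∀ b {P : T b → Set} → (∀ p → Dec (P p)) → Dec (Σ (T b) P)
Σ-T? true  P? = map′ (tt ,_) proj₂ (P? tt)
Σ-T? false _  = no proj₁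

any?-↔ : ∀ {A : Set} {n} {P : A → Set} → A ↔ Fin n → (∀ a → Dec (P a)) → Dec (∃ P)
any?-↔ {P = P} A↔Fin P? =
  map′ (λ (i , p) → from i , p)
       (λ (a , p) → to a , subst P (sym (strictlyInverseʳ a)) p)
       (any? (P? ∘ from))
  where open Inverse A↔Fin

infixr 9 _∘ʰ_
_∘ʰ_ : ∀ {F G H} → Hom G H → Hom F G → Hom F H
g ∘ʰ f = record { map = map g ∘ map f ; pres = pres g ∘ pres f }

inclusion : (G : Graph) (S : VSubset G) → Hom (induced G S) G
inclusion G S = record { map = proj₁ ; pres = λ e → e }

hull-hom : ∀ {G H} (c₀ c : Hom G H) → Hom (hull G H c₀) H
hull-hom c₀ c = record { map = map c ; pres = λ e → e c }

module _ {G H : Graph} (U : VSubset G)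
         (a : Hom (induced G U) H) (b : Hom (G minus U) H) where

  CrossCompatible : Set
  CrossCompatible = ∀ {u x} (u∈U : T (U u)) (x∉U : T (not (U x))) →
    E G u x → E H (map a (u , u∈U)) (map b (x , x∉U))

  CrossViolation : Set
  CrossViolation = ∃₂ λ u x → Σ (T (U u)) λ u∈U → Σ (T (not (U x))) λ x∉U →
    E G u x × ¬ E H (map a (u , u∈U)) (map b (x , x∉U))

  glue : CrossCompatible → Hom G H
  glue compatible = record
    { map  = λ v → paint v (T-or-T-not (U v))
    ; pres = λ {u} {v} → pres-at (T-or-T-not (U u)) (T-or-T-not (U v))
    }
    where
    paint : ∀ v → T (U v) ⊎ T (not (U v)) → V H
    paint v (inj₁ v∈U) = map a (v , v∈U)
    paint v (inj₂ v∉U) = map b (v , v∉U)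

    pres-at : ∀ {u v} (su : T (U u) ⊎ T (not (U u))) (sv : T (U v) ⊎ T (not (U v))) →
      E G u v → E H (paint u su) (paint v sv)
    pres-at (inj₁ u∈U) (inj₁ v∈U) e = pres a e
    pres-at (inj₂ u∉U) (inj₂ v∉U) e = pres b e
    pres-at (inj₁ u∈U) (inj₂ v∉U) e = compatible u∈U v∉U e
    pres-at (inj₂ u∉U) (inj₁ v∈U) e = E-sym H (compatible v∈U u∉U (E-sym G e))

  crossViolation? : Finite G → DecAdj G → DecAdj H → Dec CrossViolation
  crossViolation? (_ , V↔Fin) decG decH =
    any?-↔ V↔Fin λ u → any?-↔ V↔Fin λ x →
      Σ-T? (U u) λ u∈U → Σ-T? (not (U x)) λ x∉U →
        decG u x ×-dec ¬? (decH (map a (u , u∈U)) (map b (x , x∉U)))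

  ¬violation⇒compatible : DecAdj H → ¬ CrossViolation → CrossCompatible
  ¬violation⇒compatible decH ¬violation {u} {x} u∈U x∉U e =
    decidable-stable (decH _ _) λ ¬h → ¬violation (u , x , u∈U , x∉U , e , ¬h)

  crossViolation : ¬ Hom G H → Finite G → DecAdj G → DecAdj H → CrossViolation
  crossViolation noHom finG decG decH =
    decidable-stable (crossViolation? finG decG decH)
      (noHom ∘ glue ∘ ¬violation⇒compatible decH)

lemma1 : (H G : Graph) → Finite H → DecAdj H → Finite G → DecAdj G →
    (mo : MinObs G H) →
    (U W : VSubset G) →
    (U≠∅ : ∃ λ u → T (U u)) → (∃ λ w → T (W w)) →
    (∀ v → T (U v) → ¬ T (W v)) →
    let J = hull (G minus U) H (properHom mo (compl {G} U) (proj₁ U≠∅ , ∈⇒¬∈compl (U (proj₁ U≠∅)) (proj₂ U≠∅))) in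
    (φ : Hom (induced G U) (induced J (λ x → W (proj₁ x)))) →
    Σ (V G) λ u → Σ (T (U u)) λ u∈U →
      ¬ ((x : V G) → (x∉U : T (not (U x))) → E G u x →
         E J (proj₁ (map φ (u , u∈U))) (x , x∉U))
lemma1 H G _ decH finG decG mo U W (u₀ , u₀∈U) _ _ φ =
  let (u , x , u∈U , x∉U , ux , ¬c₀ux) = crossViolation U (c₀∘φ) c₀ (noHom mo) finG decG decH
  in u , u∈U , λ adjacent → ¬c₀ux (adjacent x x∉U ux c₀)
  where
  c₀ : Hom (G minus U) H
  c₀ = properHom mo (compl {G} U) (u₀ , ∈⇒¬∈compl (U u₀) u₀∈U)

  c₀∘φ : Hom (induced G U) H
  c₀∘φ = hull-hom c₀ c₀ ∘ʰ inclusion _ _ ∘ʰ φ
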